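{- Let $V$ be a finite set and $E_1,E_2$ equivalence relations on $V$. For any $E_1$-class $[x]_{E_1}$: there exists an $E_2$-class $[z]_{E_2}$ with $|[x]_{E_1}\cap[z]_{E_2}|=1$ if and only if there do not exist $Y,Z\subseteq V$ with $[x]_{E_1}=Y\cup Z$, $Y\cap Z=\emptyset$ and $\mathbf{u}_{E_2}(Y)=\mathbf{u}_{E_2}(Z)=\mathbf{u}_{E_2}([x]_{E_1})$.
   Context: $\mathbf{u}_E(X)=\{x\in V:[x]_E\cap X\neq\emptyset\}$ for an equivalence relation $E$ on $V$. -}

module Defs where

open import Level using (0ℓ)
open import Data.Fin using (Fin)
open import Data.Fin.Subset using (Subset; _∩_)
open import Data.Fin.Subset.Properties using (nonempty?)
open import Data.Vec using (tabulate)
open import Relation.Binary.Core using (Rel)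
open import Relation.Binary.Structures using (IsDecEquivalence)
open import Relation.Nullary.Decidable using (does)

cls : ∀ {n} {_≈_ : Rel (Fin n) 0ℓ} → IsDecEquivalence _≈_ → Fin n → Subset n
cls E x = tabulate (λ y → does (IsDecEquivalence._≟_ E x y))

u : ∀ {n} {_≈_ : Rel (Fin n) 0ℓ} → IsDecEquivalence _≈_ → Subset n → Subset n
u E X = tabulate (λ y → does (nonempty? (cls E y ∩ X)))

-- If X meets some class [z] in a single point p, then in any splitting X = Y ∪ Z both halves
-- must still reach [z], and can only do so through p, so Y ∩ Z ≠ ∅.  Conversely, if X meets
-- no class in exactly one point, let Y consist of the least element (in the order of Fin n)
-- of each nonempty X ∩ [z] and Z of the rest: Y reaches every class X reaches, and so does Z,
-- because each such X ∩ [z] has a second element.  Nothing about E₁ is used: the equivalence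
-- holds for every subset X of V in place of [x]_{E₁}.
module Submission where

open import Defs
open import Level using (0ℓ)
open import Data.Nat using (ℕ)
open import Data.Fin using (Fin)
open import Data.Fin.Subset using (Subset; _∩_; _∪_; ⊥; ∣_∣)
open import Data.Product using (_×_; ∃-syntax)
open import Function.Bundles using (_⇔_)
open import Relation.Binary.Core using (Rel)
open import Relation.Binary.Structures using (IsDecEquivalence)
open import Relation.Binary.PropositionalEquality using (_≡_)
open import Relation.Nullary using (¬_)

import Data.Nat as ℕ
import Data.Nat.Properties as ℕ
open import Data.Bool using (true)
open import Data.Fin using (_<_; fromℕ<; inject)
open import Data.Fin.Properties
  using (any?; _<?_; <-cmp; ¬∀⟶∃¬-smallest; toℕ-inject; toℕ-fromℕ<; toℕ-injective)
  renaming (_≟_ to _≟ᶠ_)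
open import Data.Fin.Subset using (_∈_; _⊆_; ∁; ⊤; ⁅_⁆; Nonempty)
open import Data.Fin.Subset.Properties
  using (_∈?_; ∣⁅x⁆∣≡1; p⊂q⇒∣p∣<∣q∣; ⊆-antisym; x∈⁅x⁆; x∈⁅y⁆⇒x≡y;
         x∈p∩q⁺; x∈p∩q⁻; x∈p∪q⁺; p∩q⊆p; Empty-unique; ∉⊥;
         x∉p⇒x∈∁p; x∈∁p⇒x∉p; ∩-identityʳ; ∪-inverseˡ; ∩-distribˡ-∪;
         nonempty?; ∣⊥∣≡0)
open import Data.Product using (_,_; proj₂)
open import Data.Sum using (_⊎_; inj₁; inj₂)
open import Data.Vec using (tabulate)
open import Data.Vec.Properties using (lookup∘tabulate; []=⇒lookup; lookup⇒[]=)
open import Function using (_∘_)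
open import Function.Bundles using (mk⇔; Equivalence)
open import Relation.Binary.Definitions using (tri<; tri≈; tri>)
open import Relation.Binary.PropositionalEquality using (sym; trans; subst; cong; module ≡-Reasoning)
open import Relation.Nullary using (Dec; yes; no; does; ¬?; _×-dec_; contradiction)
open import Relation.Nullary.Decidable using (dec-true; decidable-stable)
open import Relation.Unary using (Pred; Decidable; Satisfiable)

private
  variable
    n : ℕ

∈-tabulate-does⇔ : ∀ {p} {P : Pred (Fin n) p} (P? : Decidable P) {i} →
                   i ∈ tabulate (does ∘ P?) ⇔ P i
∈-tabulate-does⇔ P? {i} = mk⇔
  (λ i∈ → does-true (P? i) (trans (sym (lookup∘tabulate (does ∘ P?) i)) ([]=⇒lookup i∈)))
  (λ Pi → lookup⇒[]= i _ (trans (lookup∘tabulate (does ∘ P?) i) (dec-true (P? i) Pi)))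
  where
  does-true : ∀ {a} {A : Set a} (a? : Dec A) → does a? ≡ true → A
  does-true (yes a) _  = a
  does-true (no _)  ()

least : ∀ {p} {P : Pred (Fin n) p} → Decidable P → Satisfiable P →
        ∃[ m ] (P m × ∀ {k} → k < m → ¬ P k)
least {n} {P = P} P? (i , Pi)
  with ¬∀⟶∃¬-smallest n (¬_ ∘ P) (¬? ∘ P?) (λ ∀¬P → ∀¬P i Pi)
... | m , ¬¬Pm , ¬P-below = m , decidable-stable (P? m) ¬¬Pm , ¬P<m
  where
  ¬P<m : ∀ {k} → k < m → ¬ P k
  ¬P<m {k} k<m = subst (¬_ ∘ P) inject-fromℕ< (¬P-below (fromℕ< k<m))
    where
    inject-fromℕ< : inject (fromℕ< k<m) ≡ k
    inject-fromℕ< = toℕ-injective (trans (toℕ-inject (fromℕ< k<m)) (toℕ-fromℕ< k<m))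

x∈p⇒⁅x⁆⊆p : ∀ {p : Subset n} {x} → x ∈ p → ⁅ x ⁆ ⊆ p
x∈p⇒⁅x⁆⊆p {p = p} {x} x∈p y∈⁅x⁆ = subst (_∈ p) (sym (x∈⁅y⁆⇒x≡y x y∈⁅x⁆)) x∈p

∣p∣≡1⇒x≡y : ∀ {p : Subset n} {x y} → ∣ p ∣ ≡ 1 → x ∈ p → y ∈ p → x ≡ y
∣p∣≡1⇒x≡y {p = p} {x} {y} ∣p∣≡1 x∈p y∈p = decidable-stable (x ≟ᶠ y) λ x≢y →
  ℕ.<-irrefl (sym ∣p∣≡1) (subst (ℕ._< ∣ p ∣) (∣⁅x⁆∣≡1 x)
    (p⊂q⇒∣p∣<∣q∣ (x∈p⇒⁅x⁆⊆p x∈p , y , y∈p , x≢y ∘ sym ∘ x∈⁅y⁆⇒x≡y x)))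

∣p∣≢1⇒∃y≢x : ∀ {p : Subset n} {x} → ¬ ∣ p ∣ ≡ 1 → x ∈ p → ∃[ y ] (y ∈ p × ¬ y ≡ x)
∣p∣≢1⇒∃y≢x {p = p} {x} ∣p∣≢1 x∈p =
  decidable-stable (any? λ y → (y ∈? p) ×-dec ¬? (y ≟ᶠ x)) λ ∄y≢x →
    ∣p∣≢1 (trans (cong ∣_∣ (⊆-antisym (p⊆⁅x⁆ ∄y≢x) (x∈p⇒⁅x⁆⊆p x∈p))) (∣⁅x⁆∣≡1 x))
  where
  p⊆⁅x⁆ : ¬ (∃[ y ] (y ∈ p × ¬ y ≡ x)) → p ⊆ ⁅ x ⁆
  p⊆⁅x⁆ ∄y≢x {y} y∈p =
    subst (_∈ ⁅ x ⁆) (sym (decidable-stable (y ≟ᶠ x) λ y≢x → ∄y≢x (y , y∈p , y≢x))) (x∈⁅x⁆ x)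

∣p∣≢0⇒Nonempty : ∀ {p : Subset n} → ¬ ∣ p ∣ ≡ 0 → Nonempty p
∣p∣≢0⇒Nonempty {n} {p} ∣p∣≢0 = decidable-stable (nonempty? p) λ ∄x∈p →
  ∣p∣≢0 (trans (cong ∣_∣ (Empty-unique ∄x∈p)) (∣⊥∣≡0 n))

p≡p∩∁q∪p∩q : ∀ (p q : Subset n) → p ≡ p ∩ ∁ q ∪ p ∩ q
p≡p∩∁q∪p∩q p q = begin
  p                ≡⟨ ∩-identityʳ p ⟨
  p ∩ ⊤            ≡⟨ cong (p ∩_) (∪-inverseˡ q) ⟨
  p ∩ (∁ q ∪ q)    ≡⟨ ∩-distribˡ-∪ p (∁ q) q ⟩
  p ∩ ∁ q ∪ p ∩ q  ∎
  where open ≡-Reasoning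

p∩∁q∩[p∩q]≡⊥ : ∀ (p q : Subset n) → (p ∩ ∁ q) ∩ (p ∩ q) ≡ ⊥
p∩∁q∩[p∩q]≡⊥ p q = Empty-unique λ (x , x∈) →
  let x∈p∩∁q , x∈p∩q = x∈p∩q⁻ (p ∩ ∁ q) (p ∩ q) x∈
  in x∈∁p⇒x∉p (proj₂ (x∈p∩q⁻ p (∁ q) x∈p∩∁q)) (proj₂ (x∈p∩q⁻ p q x∈p∩q))

module _ {_≈_ : Rel (Fin n) 0ℓ} (E : IsDecEquivalence _≈_) where
  open IsDecEquivalence E using (_≟_) renaming (refl to ≈-refl; sym to ≈-sym; trans to ≈-trans)
  open Equivalence

  ∈-cls⇔ : ∀ {i j} → j ∈ cls E i ⇔ i ≈ j
  ∈-cls⇔ {i} = ∈-tabulate-does⇔ (i ≟_)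

  ∈-u⇔ : ∀ {X w} → w ∈ u E X ⇔ (∃[ j ] (j ∈ X × w ≈ j))
  ∈-u⇔ {X} {w} = mk⇔ witness reached
    where
    ∈-u⇔Nonempty : w ∈ u E X ⇔ Nonempty (cls E w ∩ X)
    ∈-u⇔Nonempty = ∈-tabulate-does⇔ (λ y → nonempty? (cls E y ∩ X))
    witness : w ∈ u E X → ∃[ j ] (j ∈ X × w ≈ j)
    witness w∈uX with to ∈-u⇔Nonempty w∈uX
    ... | j , j∈[w]∩X = let j∈[w] , j∈X = x∈p∩q⁻ (cls E w) X j∈[w]∩X
                        in j , j∈X , to ∈-cls⇔ j∈[w]
    reached : ∃[ j ] (j ∈ X × w ≈ j) → w ∈ u E X
    reached (j , j∈X , w≈j) = from ∈-u⇔Nonempty (j , x∈p∩q⁺ (from ∈-cls⇔ w≈j , j∈X))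

  u-mono : ∀ {X X′} → X ⊆ X′ → u E X ⊆ u E X′
  u-mono X⊆X′ w∈uX with to ∈-u⇔ w∈uX
  ... | j , j∈X , w≈j = from ∈-u⇔ (j , X⊆X′ j∈X , w≈j)

  Splitting : Subset n → Subset n → Subset n → Set
  Splitting X Y Z = X ≡ Y ∪ Z × Y ∩ Z ≡ ⊥ × u E Y ≡ u E X × u E Z ≡ u E X

  u≡u⇒witness : ∀ {X Y j z} → u E Y ≡ u E X → j ∈ X → z ≈ j → ∃[ q ] (q ∈ Y × z ≈ q)
  u≡u⇒witness {j = j} {z} uY≡uX j∈X z≈j = to ∈-u⇔ (subst (z ∈_) (sym uY≡uX) (from ∈-u⇔ (j , j∈X , z≈j)))

  splitting⇒∣X∩cls∣≢1 : ∀ {X Y Z z} → Splitting X Y Z → ¬ ∣ X ∩ cls E z ∣ ≡ 1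
  splitting⇒∣X∩cls∣≢1 {X} {Y} {Z} {z} (X≡Y∪Z , Y∩Z≡⊥ , uY≡uX , uZ≡uX) ∣X∩[z]∣≡1
    with ∣p∣≢0⇒Nonempty (λ ∣X∩[z]∣≡0 → ℕ.1+n≢0 (trans (sym ∣X∩[z]∣≡1) ∣X∩[z]∣≡0))
  ... | p , p∈X∩[z]
    with x∈p∩q⁻ X (cls E z) p∈X∩[z]
  ... | p∈X , p∈[z]
    with u≡u⇒witness uY≡uX p∈X (to ∈-cls⇔ p∈[z]) | u≡u⇒witness uZ≡uX p∈X (to ∈-cls⇔ p∈[z])
  ... | q , q∈Y , z≈q | r , r∈Z , z≈r =
    ∉⊥ (subst (q ∈_) Y∩Z≡⊥ (x∈p∩q⁺ (q∈Y , subst (_∈ Z) (sym q≡r) r∈Z)))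
    where
    ∈X∩[z] : ∀ {j} → j ∈ Y ⊎ j ∈ Z → z ≈ j → j ∈ X ∩ cls E z
    ∈X∩[z] {j} j∈Y⊎Z z≈j = x∈p∩q⁺ (subst (j ∈_) (sym X≡Y∪Z) (x∈p∪q⁺ j∈Y⊎Z) , from ∈-cls⇔ z≈j)
    q≡r : q ≡ r
    q≡r = ∣p∣≡1⇒x≡y ∣X∩[z]∣≡1 (∈X∩[z] (inj₁ q∈Y) z≈q) (∈X∩[z] (inj₂ r∈Z) z≈r)

  module _ (X : Subset n) where

    Preceded : Fin n → Set
    Preceded c = ∃[ j ] (j < c × j ∈ X × c ≈ j)

    preceded? : Decidable Preceded
    preceded? c = any? λ j → (j <? c) ×-dec (j ∈? X) ×-dec (c ≟ j)

    preceded firsts rest : Subset n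
    preceded = tabulate (does ∘ preceded?)
    firsts   = X ∩ ∁ preceded
    rest     = X ∩ preceded

    ∈-preceded⇔ : ∀ {c} → c ∈ preceded ⇔ Preceded c
    ∈-preceded⇔ = ∈-tabulate-does⇔ preceded?

    ∈-u⇒first-witness : ∀ {w} → w ∈ u E X → ∃[ m ] (m ∈ X × w ≈ m × ¬ Preceded m)
    ∈-u⇒first-witness w∈uX with to ∈-u⇔ w∈uX
    ... | j , j∈X , w≈j with least (λ k → (k ∈? X) ×-dec (j ≟ k)) (j , j∈X , ≈-refl)
    ... | m , (m∈X , j≈m) , minimal =
      m , m∈X , ≈-trans w≈j j≈m ,
      λ (k , k<m , k∈X , m≈k) → minimal k<m (k∈X , ≈-trans j≈m m≈k)

    u-firsts≡u-X : u E firsts ≡ u E X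
    u-firsts≡u-X = ⊆-antisym (u-mono (p∩q⊆p X (∁ preceded))) λ w∈uX →
      let m , m∈X , w≈m , ¬preceded = ∈-u⇒first-witness w∈uX
      in from ∈-u⇔ (m , x∈p∩q⁺ (m∈X , x∉p⇒x∈∁p (¬preceded ∘ to ∈-preceded⇔)) , w≈m)

    u-rest≡u-X : (∀ z → ¬ ∣ X ∩ cls E z ∣ ≡ 1) → u E rest ≡ u E X
    u-rest≡u-X ∣X∩cls∣≢1 = ⊆-antisym (u-mono (p∩q⊆p X preceded)) reaches-rest
      where
      reaches-rest : u E X ⊆ u E rest
      reaches-rest w∈uX
        with ∈-u⇒first-witness w∈uX
      ... | m , m∈X , w≈m , ¬preceded
        with ∣p∣≢1⇒∃y≢x (∣X∩cls∣≢1 m) (x∈p∩q⁺ (m∈X , from ∈-cls⇔ ≈-refl))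
      ... | k , k∈X∩[m] , k≢m
        with x∈p∩q⁻ X (cls E m) k∈X∩[m]
      ... | k∈X , k∈[m]
        with to ∈-cls⇔ k∈[m] | <-cmp k m
      ... | m≈k | tri< k<m _ _ = contradiction (k , k<m , k∈X , m≈k) ¬preceded
      ... | m≈k | tri≈ _ k≡m _ = contradiction k≡m k≢m
      ... | m≈k | tri> _ _ m<k = from ∈-u⇔
            (k , x∈p∩q⁺ (k∈X , from ∈-preceded⇔ (m , m<k , m∈X , ≈-sym m≈k)) , ≈-trans w≈m m≈k)

    firsts-rest-splitting : (∀ z → ¬ ∣ X ∩ cls E z ∣ ≡ 1) → Splitting X firsts rest
    firsts-rest-splitting ∣X∩cls∣≢1 =
      p≡p∩∁q∪p∩q X preceded , p∩∁q∩[p∩q]≡⊥ X preceded , u-firsts≡u-X , u-rest≡u-X ∣X∩cls∣≢1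

  ∃∣X∩cls∣≡1⇔¬∃Splitting : ∀ X → (∃[ z ] ∣ X ∩ cls E z ∣ ≡ 1) ⇔ (¬ (∃[ Y ] ∃[ Z ] Splitting X Y Z))
  ∃∣X∩cls∣≡1⇔¬∃Splitting X = mk⇔ unsplittable unique-meeting
    where
    unsplittable : ∃[ z ] ∣ X ∩ cls E z ∣ ≡ 1 → ¬ (∃[ Y ] ∃[ Z ] Splitting X Y Z)
    unsplittable (z , ∣X∩[z]∣≡1) (Y , Z , splitting) = splitting⇒∣X∩cls∣≢1 splitting ∣X∩[z]∣≡1
    unique-meeting : ¬ (∃[ Y ] ∃[ Z ] Splitting X Y Z) → ∃[ z ] ∣ X ∩ cls E z ∣ ≡ 1
    unique-meeting ∄splitting = decidable-stable (any? λ z → ∣ X ∩ cls E z ∣ ℕ.≟ 1) λ ∄z →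
      ∄splitting (firsts X , rest X , firsts-rest-splitting X λ z ∣X∩[z]∣≡1 → ∄z (z , ∣X∩[z]∣≡1))

mainTheorem13 : ∀ {n} {_≈₁_ _≈₂_ : Rel (Fin n) 0ℓ}
    (E₁ : IsDecEquivalence _≈₁_) (E₂ : IsDecEquivalence _≈₂_) (x : Fin n) →
    (∃[ z ] ∣ cls E₁ x ∩ cls E₂ z ∣ ≡ 1)
    ⇔ (¬ (∃[ Y ] ∃[ Z ] (cls E₁ x ≡ Y ∪ Z × Y ∩ Z ≡ ⊥
    × u E₂ Y ≡ u E₂ (cls E₁ x) × u E₂ Z ≡ u E₂ (cls E₁ x))))
mainTheorem13 E₁ E₂ x = ∃∣X∩cls∣≡1⇔¬∃Splitting E₂ (cls E₁ x)
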